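{- Let $X$ and $Y$ be strings with $X\approx Y$, and let $a,b\in[1,|Y|]$ with $a\le b$ be such that $Y[a]$ is a minimum of $Y[a\mathinner{.\,.} b]$. Then $X[1\mathinner{.\,.} a]\cdot X(b\mathinner{.\,.} |X|]\approx Y[1\mathinner{.\,.} a]\cdot Y(b\mathinner{.\,.} |X|]$.
   Context: Strings are over a totally ordered alphabet; $X[i]$ is the $i$-th character (1-indexed), $X[i\mathinner{.\,.} j]$ denotes $X[i]\cdots X[j]$ and $X(i\mathinner{.\,.} j]$ denotes $X[i+1]\cdots X[j]$; $\cdot$ is concatenation. The leftmost minimum of a nonempty string $S$ is $S[t]$ for the smallest index $t$ at which the minimum value occurs. The Cartesian tree $\mathsf{CT}(S)$: empty for the empty string; otherwise a root with left subtree $\mathsf{CT}(S[1\mathinner{.\,.} t-1])$ and right subtree $\mathsf{CT}(S[t+1\mathinner{.\,.} |S|])$, where $S[t]$ is the leftmost minimum. $S\approx S'$ iff $\mathsf{CT}(S)=\mathsf{CT}(S')$. -}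

module Defs where

open import Level using (Level)
open import Data.Nat using (ℕ; zero; suc; _≤_)
open import Relation.Nullary using (¬_)
open import Relation.Binary.PropositionalEquality using (_≡_)
open import Data.List using (List; []; _∷_; length)
open import Data.Product using (_×_; _,_)
open import Data.Maybe using (Maybe; just; nothing)
open import Relation.Nullary using (yes; no)
open import Relation.Binary.Bundles using (StrictTotalOrder)

-- Shapes of (unlabelled) binary trees: Cartesian trees are compared as shapes.
data Tree : Set where
  leaf : Tree
  node : Tree → Tree → Tree

-- 1-indexed character access: X ‼ i = just X[i] if 1 ≤ i ≤ |X|, else nothing.
_‼_ : ∀ {a} {A : Set a} → List A → ℕ → Maybe A
[]       ‼ _           = nothing
(x ∷ xs) ‼ zero        = nothing
(x ∷ xs) ‼ suc zero    = just x
(x ∷ xs) ‼ suc (suc i) = xs ‼ suc i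

module CartesianTree {c ℓ₁ ℓ₂ : Level} (O : StrictTotalOrder c ℓ₁ ℓ₂) where
  open StrictTotalOrder O renaming (Carrier to A)

  -- lmsplit x xs = (S[1..t-1], S[t], S[t+1..|S|]) for S = x ∷ xs,
  -- where S[t] is the leftmost minimum of S.
  lmsplit : A → List A → List A × A × List A
  lmsplit x [] = [] , x , []
  lmsplit x (y ∷ ys) with lmsplit y ys
  ... | p , m , s with m <? x
  ...   | yes _ = x ∷ p , m , s
  ...   | no  _ = [] , x , y ∷ ys

  -- Cartesian tree with fuel; fuel |S| always suffices since both parts
  -- of the split are strictly shorter than S.
  ctFuel : ℕ → List A → Tree
  ctFuel zero    _        = leaf
  ctFuel (suc n) []       = leaf
  ctFuel (suc n) (x ∷ xs) with lmsplit x xs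
  ... | p , _ , s = node (ctFuel n p) (ctFuel n s)

  CT : List A → Tree
  CT S = ctFuel (length S) S

  _≈ct_ : List A → List A → Set
  S ≈ct S' = CT S ≡ CT S'

  MinOfRange : List A → ℕ → ℕ → Set (c Level.⊔ ℓ₂)
  MinOfRange Y a b = ∀ i y z → a ≤ i → i ≤ b →
    Y ‼ a ≡ just y → Y ‼ i ≡ just z → ¬ (z < y)

{-# OPTIONS --safe #-}
-- Split X and Y at their leftmost minima: X = P m Q and Y = P′ m′ Q′ with |P| = |P′| = k,
-- P ≈ P′ and Q ≈ Q′.  If the deleted block (a..b] lies inside P′, or entirely after m′,
-- the outer split survives the deletion and we recurse into P or Q.  Otherwise the closed
-- range [a, b] contains both a position of P′ and the position k + 1 of m′ < Y[a],
-- contradicting the minimality of Y[a].  Recursing into Q can produce the start a = 0,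
-- where the minimality condition is vacuous and only a suffix of Q survives.
module Submission where

open import Defs
open import Level using (_⊔_)
open import Data.Nat using (ℕ; zero; suc; _+_; _≤_; z≤n; s≤s; s≤s⁻¹)
open import Data.Nat.Properties using (≤-refl; ≤-trans; m≤m+n; m≤n+m; +-suc; +-monoʳ-≤; +-cancelˡ-≤; m≤n⇒m≤1+n; suc-injective)
open import Data.List using (List; []; _∷_; length; take; drop; _++_)
open import Data.List.Properties using (++-assoc; length-++; ∷-injective)
open import Data.List.Relation.Unary.All as All using (All; []; _∷_)
open import Data.List.Relation.Unary.All.Properties using (++⁺; ++⁻ʳ; take⁺; drop⁺)
open import Data.Maybe using (just; nothing)
open import Data.Product using (_×_; _,_; proj₁; proj₂; ∃)
open import Data.Empty using (⊥-elim)
open import Relation.Nullary using (¬_; yes; no)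
open import Relation.Binary.PropositionalEquality
open import Relation.Binary.Bundles using (StrictTotalOrder)
open import Relation.Binary.Definitions using (tri<; tri≈; tri>)

node-injective : ∀ {l r l′ r′} → node l r ≡ node l′ r′ → l ≡ l′ × r ≡ r′
node-injective refl = refl , refl

data Position (k : ℕ) : ℕ → Set where
  within : ∀ {j} → j ≤ k → Position k j
  beyond : ∀ j → Position k (suc (k + j))

position : ∀ k j → Position k j
position k       zero    = within z≤n
position zero    (suc j) = beyond j
position (suc k) (suc j) with position k j
... | within j≤k = within (s≤s j≤k)
... | beyond i   = beyond i

module _ {ℓ} {A : Set ℓ} where

  excise : ℕ → ℕ → List A → List A
  excise a b X = take a X ++ drop b X

  excise⁺ : ∀ {p} {P : A → Set p} a b {X} → All P X → All P (excise a b X)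
  excise⁺ a b Xs = ++⁺ (take⁺ a Xs) (drop⁺ b Xs)

  take-++ˡ : ∀ (P R : List A) {a} → a ≤ length P → take a (P ++ R) ≡ take a P
  take-++ˡ P       R {zero}  _       = refl
  take-++ˡ (x ∷ P) R {suc a} (s≤s h) = cong (x ∷_) (take-++ˡ P R h)

  drop-++ˡ : ∀ (P R : List A) {b} → b ≤ length P → drop b (P ++ R) ≡ drop b P ++ R
  drop-++ˡ P       R {zero}  _       = refl
  drop-++ˡ (x ∷ P) R {suc b} (s≤s h) = drop-++ˡ P R h

  drop-++-∷ : ∀ (P : List A) m Q {k} b → length P ≡ k → drop (suc (k + b)) (P ++ m ∷ Q) ≡ drop b Q
  drop-++-∷ []      m Q b refl = refl
  drop-++-∷ (x ∷ P) m Q b refl = drop-++-∷ P m Q b refl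

  excise-++ˡ : ∀ (P R : List A) {a b} → a ≤ length P → b ≤ length P →
               excise a b (P ++ R) ≡ excise a b P ++ R
  excise-++ˡ P R {a} {b} a≤ b≤ = begin
    take a (P ++ R) ++ drop b (P ++ R)  ≡⟨ cong₂ _++_ (take-++ˡ P R a≤) (drop-++ˡ P R b≤) ⟩
    take a P ++ (drop b P ++ R)         ≡⟨ ++-assoc (take a P) (drop b P) R ⟨
    excise a b P ++ R                   ∎
    where open ≡-Reasoning

  excise-++-∷ : ∀ (P : List A) m Q {k} a b → length P ≡ k →
                excise (suc (k + a)) (suc (k + b)) (P ++ m ∷ Q) ≡ P ++ m ∷ excise a b Q
  excise-++-∷ []      m Q a b refl = refl
  excise-++-∷ (x ∷ P) m Q a b refl = cong (x ∷_) (excise-++-∷ P m Q a b refl)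

  split-shorter : ∀ {x : A} {xs P m Q} → x ∷ xs ≡ P ++ m ∷ Q →
                  length P ≤ length xs × length Q ≤ length xs
  split-shorter {P = P} {Q = Q} eq
    rewrite suc-injective (trans (cong length eq) (trans (length-++ P) (+-suc (length P) (length Q)))) =
    m≤m+n (length P) (length Q) , m≤n+m (length Q) (length P)

  ‼-zero : ∀ (X : List A) → X ‼ 0 ≡ nothing
  ‼-zero []      = refl
  ‼-zero (_ ∷ _) = refl

  ‼-++ˡ : ∀ (P R : List A) {i} → i ≤ length P → (P ++ R) ‼ i ≡ P ‼ i
  ‼-++ˡ []      R {zero}        z≤n     = ‼-zero R
  ‼-++ˡ (x ∷ P) R {zero}        _       = refl
  ‼-++ˡ (x ∷ P) R {suc zero}    _       = refl
  ‼-++ˡ (x ∷ P) R {suc (suc i)} (s≤s h) = ‼-++ˡ P R h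

  ‼-++ʳ : ∀ (P R : List A) {k} i → length P ≡ k → (P ++ R) ‼ suc (k + i) ≡ R ‼ suc i
  ‼-++ʳ []      R i refl = refl
  ‼-++ʳ (x ∷ P) R i refl = ‼-++ʳ P R i refl

  All-‼ : ∀ {p} {P : A → Set p} {X} {i} → All P X → 1 ≤ i → i ≤ length X → ∃ λ x → X ‼ i ≡ just x × P x
  All-‼ {i = suc zero}    (px ∷ _)  _ _       = _ , refl , px
  All-‼ {i = suc (suc i)} (_  ∷ Xs) _ (s≤s h) = All-‼ Xs (s≤s z≤n) h

module _ {c ℓ₁ ℓ₂} (O : StrictTotalOrder c ℓ₁ ℓ₂) where
  open StrictTotalOrder O renaming (Carrier to A; trans to <-trans)
  open CartesianTree O

  ≮-<-trans : ∀ {x y z} → ¬ y < x → y < z → x < z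
  ≮-<-trans {x} {y} y≮x y<z with compare x y
  ... | tri< x<y _   _   = <-trans x<y y<z
  ... | tri≈ _   x≈y _   = <-respˡ-≈ (Eq.sym x≈y) y<z
  ... | tri> _   _   y<x = ⊥-elim (y≮x y<x)

  LeftmostMin : List A → A → List A → Set (c ⊔ ℓ₂)
  LeftmostMin P m Q = All (m <_) P × All (λ z → ¬ z < m) Q

  leftmostMin-minimum : ∀ {P m Q} → LeftmostMin P m Q → All (λ z → ¬ z < m) (P ++ m ∷ Q)
  leftmostMin-minimum (m<P , Q≮m) = ++⁺ (All.map (λ m<z z<m → asym m<z z<m) m<P) (irrefl Eq.refl ∷ Q≮m)

  leftmostMin-unique : ∀ P m Q P′ m′ Q′ → P ++ m ∷ Q ≡ P′ ++ m′ ∷ Q′ →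
                       LeftmostMin P m Q → LeftmostMin P′ m′ Q′ → (P , m , Q) ≡ (P′ , m′ , Q′)
  leftmostMin-unique []      m Q []        m′ Q′ refl _ _ = refl
  leftmostMin-unique []      m Q (_ ∷ P′)  m′ Q′ refl (_ , Q≮m) (m′<m ∷ _ , _) =
    ⊥-elim (All.head (++⁻ʳ P′ Q≮m) m′<m)
  leftmostMin-unique (_ ∷ P) m Q []        m′ Q′ refl (m<m′ ∷ _ , _) (_ , Q′≮m′) =
    ⊥-elim (All.head (++⁻ʳ P Q′≮m′) m<m′)
  leftmostMin-unique (_ ∷ P) m Q (_ ∷ P′)  m′ Q′ eq (_ ∷ m<P , Q≮m) (_ ∷ m′<P′ , Q′≮m′)
    with refl , eq′ ← ∷-injective eq
    with refl ← leftmostMin-unique P m Q P′ m′ Q′ eq′ (m<P , Q≮m) (m′<P′ , Q′≮m′) = refl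

  lmsplit-sound : ∀ x xs {P m Q} → lmsplit x xs ≡ (P , m , Q) → x ∷ xs ≡ P ++ m ∷ Q × LeftmostMin P m Q
  lmsplit-sound x []       refl = refl , [] , []
  lmsplit-sound x (y ∷ ys) eq with lmsplit y ys in e
  ... | P , m , Q with m <? x | lmsplit-sound y ys e
  lmsplit-sound x (y ∷ ys) refl | P , m , Q | yes m<x | ys≡ , m<P , Q≮m = cong (x ∷_) ys≡ , m<x ∷ m<P , Q≮m
  lmsplit-sound x (y ∷ ys) refl | P , m , Q | no  m≮x | ys≡ , lm =
    refl , [] , subst (All (λ z → ¬ z < x)) (sym ys≡)
                      (All.map (λ z≮m z<x → m≮x (≮-<-trans z≮m z<x)) (leftmostMin-minimum lm))

  lmsplit-complete : ∀ {x xs P m Q} → x ∷ xs ≡ P ++ m ∷ Q → LeftmostMin P m Q → lmsplit x xs ≡ (P , m , Q)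
  lmsplit-complete {x} {xs} {P} {m} {Q} eq lm with eq₁ , lm₁ ← lmsplit-sound x xs refl =
    leftmostMin-unique _ _ _ P m Q (trans (sym eq₁) eq) lm₁ lm

  ctFuel-[] : ∀ n → ctFuel n [] ≡ leaf
  ctFuel-[] zero    = refl
  ctFuel-[] (suc n) = refl

  ctFuel-irrelevant : ∀ {n n′} S → length S ≤ n → length S ≤ n′ → ctFuel n S ≡ ctFuel n′ S
  ctFuel-irrelevant {n} {n′} [] _ _ = trans (ctFuel-[] n) (sym (ctFuel-[] n′))
  ctFuel-irrelevant {suc n} {suc n′} (x ∷ xs) (s≤s h) (s≤s h′) with lmsplit x xs in e
  ... | P , m , Q with split-shorter (proj₁ (lmsplit-sound x xs e))
  ... | |P|≤ , |Q|≤ = cong₂ node (ctFuel-irrelevant P (≤-trans |P|≤ h) (≤-trans |P|≤ h′))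
                                 (ctFuel-irrelevant Q (≤-trans |Q|≤ h) (≤-trans |Q|≤ h′))

  CT-∷ : ∀ {x xs P m Q} → x ∷ xs ≡ P ++ m ∷ Q → LeftmostMin P m Q → CT (x ∷ xs) ≡ node (CT P) (CT Q)
  CT-∷ {x} {xs} {P} {Q = Q} eq lm with lmsplit x xs | lmsplit-complete eq lm
  ... | _ | refl = cong₂ node (ctFuel-irrelevant P (proj₁ (split-shorter eq)) ≤-refl)
                              (ctFuel-irrelevant Q (proj₂ (split-shorter eq)) ≤-refl)

  CT-split : ∀ {P m Q} → LeftmostMin P m Q → CT (P ++ m ∷ Q) ≡ node (CT P) (CT Q)
  CT-split {[]}    = CT-∷ refl
  CT-split {_ ∷ _} = CT-∷ refl

  CT-∷≢leaf : ∀ x xs → CT (x ∷ xs) ≢ leaf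
  CT-∷≢leaf x xs eq with lmsplit x xs
  CT-∷≢leaf x xs () | _ , _ , _

  -- An inductive form of ≈ct, so that proofs about it recurse structurally rather than on fuel.
  data _∼_ : List A → List A → Set (c ⊔ ℓ₂) where
    []    : [] ∼ []
    split : ∀ {P m Q P′ m′ Q′} → LeftmostMin P m Q → LeftmostMin P′ m′ Q′ →
            P ∼ P′ → Q ∼ Q′ → (P ++ m ∷ Q) ∼ (P′ ++ m′ ∷ Q′)

  ∼⇒≈ct : ∀ {X Y} → X ∼ Y → X ≈ct Y
  ∼⇒≈ct []                  = refl
  ∼⇒≈ct (split lm lm′ P∼ Q∼) =
    trans (CT-split lm) (trans (cong₂ node (∼⇒≈ct P∼) (∼⇒≈ct Q∼)) (sym (CT-split lm′)))

  ≈ct⇒∼ : ∀ {X Y} → X ≈ct Y → X ∼ Y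
  ≈ct⇒∼ {X} = go (length X) ≤-refl
    where
    go : ∀ n {X Y} → length X ≤ n → X ≈ct Y → X ∼ Y
    go _ {[]}     {[]}     _ _  = []
    go _ {[]}     {y ∷ ys} _ eq = ⊥-elim (CT-∷≢leaf y ys (sym eq))
    go _ {x ∷ xs} {[]}     _ eq = ⊥-elim (CT-∷≢leaf x xs eq)
    go (suc n) {x ∷ xs} {y ∷ ys} (s≤s h) eq
      with X≡ , lm ← lmsplit-sound x xs refl | Y≡ , lm′ ← lmsplit-sound y ys refl
      with P≈ , Q≈ ← node-injective (trans (sym (CT-∷ X≡ lm)) (trans eq (CT-∷ Y≡ lm′)))
      = subst₂ _∼_ (sym X≡) (sym Y≡)
          (split lm lm′ (go n (≤-trans (proj₁ (split-shorter X≡)) h) P≈)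
                        (go n (≤-trans (proj₂ (split-shorter X≡)) h) Q≈))

  ∼-length : ∀ {X Y} → X ∼ Y → length X ≡ length Y
  ∼-length [] = refl
  ∼-length (split {P} {m} {Q} {P′} {m′} {Q′} _ _ P∼ Q∼) = begin
    length (P ++ m ∷ Q)          ≡⟨ length-++ P ⟩
    length P + suc (length Q)    ≡⟨ cong₂ (λ i j → i + suc j) (∼-length P∼) (∼-length Q∼) ⟩
    length P′ + suc (length Q′)  ≡⟨ length-++ P′ ⟨
    length (P′ ++ m′ ∷ Q′)       ∎
    where open ≡-Reasoning

  MinOfRange-zero : ∀ Y b → MinOfRange Y 0 b
  MinOfRange-zero Y _ _ _ _ _ _ Y‼0 _ with () ← trans (sym (‼-zero Y)) Y‼0

  MinOfRange-++ˡ : ∀ P R {a b} → b ≤ length P → MinOfRange (P ++ R) a b → MinOfRange P a b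
  MinOfRange-++ˡ P R b≤ min i y z a≤i i≤b P‼a P‼i =
    min i y z a≤i i≤b (trans (‼-++ˡ P R (≤-trans a≤i i≤)) P‼a) (trans (‼-++ˡ P R i≤) P‼i)
    where i≤ = ≤-trans i≤b b≤

  MinOfRange-++-∷ : ∀ P m Q {k} a b → length P ≡ k →
                    MinOfRange (P ++ m ∷ Q) (suc (k + a)) (suc (k + b)) → MinOfRange Q a b
  MinOfRange-++-∷ P m Q zero b _ _ i y z _ _ Q‼0 _ with () ← trans (sym (‼-zero Q)) Q‼0
  MinOfRange-++-∷ P m Q {k} (suc a) b |P| min (suc i) y z a≤i i≤b Q‼a Q‼i =
    min (suc (k + suc i)) y z (s≤s (+-monoʳ-≤ k a≤i)) (s≤s (+-monoʳ-≤ k i≤b))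
        (trans (‼-++ʳ P (m ∷ Q) (suc a) |P|) Q‼a) (trans (‼-++ʳ P (m ∷ Q) (suc i) |P|) Q‼i)

  ¬MinOfRange-across : ∀ {P m Q a} b → All (m <_) P → 1 ≤ a → a ≤ length P →
                       ¬ MinOfRange (P ++ m ∷ Q) a (suc (length P + b))
  ¬MinOfRange-across {P} {m} {Q} {a} b m<P 1≤a a≤k min with All-‼ m<P 1≤a a≤k
  ... | y , P‼a , m<y = min (suc (k + 0)) y m (m≤n⇒m≤1+n (≤-trans a≤k (m≤m+n k 0)))
                          (s≤s (+-monoʳ-≤ k z≤n)) (trans (‼-++ˡ P (m ∷ Q) a≤k) P‼a)
                          (‼-++ʳ P (m ∷ Q) 0 refl) m<y
    where k = length P

  CT-excise-within : ∀ {P m Q k a b} → LeftmostMin P m Q → length P ≡ k → a ≤ b → b ≤ k →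
                     CT (excise a b (P ++ m ∷ Q)) ≡ node (CT (excise a b P)) (CT Q)
  CT-excise-within {P} {m} {Q} {a = a} {b} (m<P , Q≮m) refl a≤b b≤k =
    trans (cong CT (excise-++ˡ P (m ∷ Q) (≤-trans a≤b b≤k) b≤k)) (CT-split (excise⁺ a b m<P , Q≮m))

  CT-excise-beyond : ∀ {P m Q k} a b → LeftmostMin P m Q → length P ≡ k →
                     CT (excise (suc (k + a)) (suc (k + b)) (P ++ m ∷ Q)) ≡ node (CT P) (CT (excise a b Q))
  CT-excise-beyond {P} {m} {Q} a b (m<P , Q≮m) |P| =
    trans (cong CT (excise-++-∷ P m Q a b |P|)) (CT-split (m<P , excise⁺ a b Q≮m))

  excise-∼ : ∀ {X Y} → X ∼ Y → ∀ a b → a ≤ b → MinOfRange Y a b → excise a b X ≈ct excise a b Y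
  excise-∼ [] a b _ _ = refl
  excise-∼ (split {P} {m} {Q} {P′} {m′} {Q′} lm lm′ P∼ Q∼) a b a≤b min with position (length P′) b
  ... | within b≤k = begin
    CT (excise a b (P ++ m ∷ Q))        ≡⟨ CT-excise-within lm |P| a≤b b≤k ⟩
    node (CT (excise a b P)) (CT Q)     ≡⟨ cong₂ node (excise-∼ P∼ a b a≤b (MinOfRange-++ˡ P′ (m′ ∷ Q′) b≤k min))
                                                      (∼⇒≈ct Q∼) ⟩
    node (CT (excise a b P′)) (CT Q′)   ≡⟨ CT-excise-within lm′ refl a≤b b≤k ⟨
    CT (excise a b (P′ ++ m′ ∷ Q′))     ∎
    where open ≡-Reasoning
          |P| = ∼-length P∼
  ... | beyond b′ with position (length P′) a
  ... | beyond a′ = begin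
    CT (excise a (suc (k + b′)) (P ++ m ∷ Q))    ≡⟨ CT-excise-beyond a′ b′ lm (∼-length P∼) ⟩
    node (CT P) (CT (excise a′ b′ Q))            ≡⟨ cong₂ node (∼⇒≈ct P∼)
                                                      (excise-∼ Q∼ a′ b′ (+-cancelˡ-≤ k a′ b′ (s≤s⁻¹ a≤b))
                                                        (MinOfRange-++-∷ P′ m′ Q′ a′ b′ refl min)) ⟩
    node (CT P′) (CT (excise a′ b′ Q′))          ≡⟨ CT-excise-beyond a′ b′ lm′ refl ⟨
    CT (excise a (suc (k + b′)) (P′ ++ m′ ∷ Q′)) ∎
    where open ≡-Reasoning
          k = length P′
  excise-∼ (split {P} {m} {Q} {P′} {m′} {Q′} lm lm′ P∼ Q∼) zero _ _ _ | beyond b′ | within _ =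
    begin
    CT (drop (suc (length P′ + b′)) (P ++ m ∷ Q))    ≡⟨ cong CT (drop-++-∷ P m Q b′ (∼-length P∼)) ⟩
    CT (drop b′ Q)                                   ≡⟨ excise-∼ Q∼ 0 b′ z≤n (MinOfRange-zero Q′ b′) ⟩
    CT (drop b′ Q′)                                  ≡⟨ cong CT (drop-++-∷ P′ m′ Q′ b′ refl) ⟨
    CT (drop (suc (length P′ + b′)) (P′ ++ m′ ∷ Q′)) ∎
    where open ≡-Reasoning
  excise-∼ (split _ (m′<P′ , _) _ _) (suc a) _ _ min | beyond b′ | within a≤k =
    ⊥-elim (¬MinOfRange-across b′ m′<P′ (s≤s z≤n) a≤k min)

lemma29 : ∀ {c ℓ₁ ℓ₂} (O : StrictTotalOrder c ℓ₁ ℓ₂) →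
    (X Y : List (StrictTotalOrder.Carrier O)) →
    CartesianTree._≈ct_ O X Y →
    (a b : ℕ) → 1 ≤ a → a ≤ b → b ≤ length Y →
    CartesianTree.MinOfRange O Y a b →
    CartesianTree._≈ct_ O (take a X ++ drop b X) (take a Y ++ drop b Y)
lemma29 O X Y X≈Y a b _ a≤b _ min = excise-∼ O (≈ct⇒∼ O X≈Y) a b a≤b min
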